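{- Let $\Gamma$ be a finite abelian group of order $n$, $A=-A\subseteq\Gamma\setminus\{0\}$, $G=G(\Gamma,A)$ the Cayley graph, $\chi$ a nontrivial character of $\Gamma$ with $m=|\chi(\Gamma)|$, and $\rho:\Gamma\to\mathbb{Z}/m\mathbb{Z}$ the homomorphism with $\chi(\gamma)=e^{2\pi i\rho(\gamma)/m}$. Let $d,\ell,s,t$ be positive integers and $0<\delta'\le1$ a real, and suppose that (i) $0\le s-d<s+\ell\le t-d<t+\ell\le m/2$; (ii) $G$ satisfies $\mathrm{DISC}_2(\delta')$; (iii) $\ell-d\ge\delta'm$; (iv) $n\sim_{\delta'/2}(n-1)$. Then, with $d_1=t-s-\ell$ and $d_2=t-s+\ell$, $$\left||A\cap\rho^{ -1}([d_1,d_2))|-2\ell\frac{|A|}{m}\right|\le\frac{|A|}{m}\left(d+\frac{2\delta'}{d}\big((\ell+d)^2+\ell^2\big)\right).$$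
   Context: The Cayley graph $G(\Gamma,A)$ has vertex set $\Gamma$, with $\gamma,\gamma'$ adjacent iff $\gamma'-\gamma\in A$; $e(G)=n|A|/2$. A character is a homomorphism $\Gamma\to S^1\subset\mathbb{C}$. Write $x\sim_\delta y$ if $(1-\delta)y\le x\le(1+\delta)y$. For integers $D_1\le D_2$, $\rho^{ -1}([D_1,D_2))$ is the set of $\gamma$ with $\rho(\gamma)\equiv f\pmod m$ for some integer $D_1\le f<D_2$. Property $\mathrm{DISC}_2(\delta')$: for all disjoint $U,W\subseteq\Gamma$ with $|U|,|W|\ge\delta'n$, the number $e_G(U,W)$ of edges with one endpoint in $U$ and one in $W$ satisfies $e_G(U,W)\sim_{\delta'}e(G)|U||W|/\binom n2$.
   Formalization: The parameter $\delta'$ is taken to be rational rather than real. -}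

module Defs where

open import Data.Nat as ℕ using (ℕ; NonZero)
open import Data.Nat.Combinatorics using (_C_)
open import Data.Integer as ℤ using (ℤ; +_)
open import Data.Integer.Divisibility as ℤD using ()
open import Data.Rational as ℚ using (ℚ; _/_; 1ℚ; _≤_; _*_; _+_; _-_)
open import Data.Fin using (Fin)
open import Data.Fin.Subset using (Subset; _∈_; ∣_∣)
open import Data.Vec using (lookup)
open import Data.Bool using (Bool; true; false; _∧_)
open import Data.List using (List; map; allFin)
open import Data.Nat.ListAction using (sum)
open import Data.Product using (Σ; _×_; ∃-syntax)
open import Data.Empty using (⊥)
open import Relation.Binary.PropositionalEquality using (_≡_)
open import Algebra.Structures using (IsAbelianGroup)

-- A finite abelian group of order n, realised on the carrier Fin n
-- (every finite abelian group of order n is isomorphic to such a one).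
record FinAbGroup (n : ℕ) : Set where
  field
    _⊕_ : Fin n → Fin n → Fin n
    0g  : Fin n
    ⊝_  : Fin n → Fin n
    isAbelianGroup : IsAbelianGroup _≡_ _⊕_ 0g ⊝_
  infixl 6 _⊕_
  infix 8 ⊝_

⟦_⟧ : ℕ → ℚ
⟦ k ⟧ = + k / 1

_∼[_]_ : ℚ → ℚ → ℚ → Set
x ∼[ δ ] y = ((1ℚ - δ) * y ≤ x) × (x ≤ (1ℚ + δ) * y)

module _ {n : ℕ} (Γ : FinAbGroup n) where
  open FinAbGroup Γ

  b2n : Bool → ℕ
  b2n true  = 1
  b2n false = 0

  -- e_G(U,W) for the Cayley graph G(Γ,A): the number of pairs (u,w) with
  -- u ∈ U, w ∈ W, w - u ∈ A.  (For disjoint U, W this is the number of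
  -- edges with one endpoint in U and the other in W.)
  eBetween : (A U W : Subset n) → ℕ
  eBetween A U W =
    sum (map (λ u → sum (map (λ w →
      b2n (lookup U u ∧ lookup W w ∧ lookup A (w ⊕ ⊝ u))) (allFin n))) (allFin n))

  eG : Subset n → ℚ
  eG A = + (n ℕ.* ∣ A ∣) / 2

  Disjoint : Subset n → Subset n → Set
  Disjoint U W = ∀ x → x ∈ U → x ∈ W → ⊥

  -- DISC_2(δ'), with  e_G(U,W) ∼ e(G)|U||W| / (n choose 2)  written with the
  -- positive denominator (n choose 2) multiplied through.
  DISC₂ : Subset n → ℚ → Set
  DISC₂ A δ = ∀ (U W : Subset n) → Disjoint U W →
    δ * ⟦ n ⟧ ≤ ⟦ ∣ U ∣ ⟧ → δ * ⟦ n ⟧ ≤ ⟦ ∣ W ∣ ⟧ →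
    (⟦ eBetween A U W ⟧ * ⟦ n C 2 ⟧) ∼[ δ ] (eG A * ⟦ ∣ U ∣ ⟧ * ⟦ ∣ W ∣ ⟧)

  -- ρ : Γ → ℤ/mℤ (values represented by Fin m) is a homomorphism
  IsHomZmod : (m : ℕ) → (Fin n → Fin m) → Set
  IsHomZmod m ρ = ∀ x y →
    (+ m) ℤD.∣ (+ Data.Fin.toℕ (ρ (x ⊕ y)) ℤ.- (+ Data.Fin.toℕ (ρ x) ℤ.+ + Data.Fin.toℕ (ρ y)))

  -- γ ∈ ρ⁻¹([D₁,D₂)) : ρ(γ) ≡ f (mod m) for some integer D₁ ≤ f < D₂
  InPreimage : (m : ℕ) → (Fin n → Fin m) → ℤ → ℤ → Fin n → Set
  InPreimage m ρ D₁ D₂ γ = ∃[ f ] ((D₁ ℤ.≤ f) × (f ℤ.< D₂) ×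
    ((+ m) ℤD.∣ (f ℤ.- + Data.Fin.toℕ (ρ γ))))

module Submission where

-- Write r γ ∈ [0, m) for the residue ρ(γ), c = t - s, and K = n/m for the common
-- size of the fibres of ρ.  For a window U = ρ⁻¹[b, b + L) and its translate
-- W = ρ⁻¹[b + c, b + c + L), an edge u → w = γ + u of the Cayley graph has γ ∈ A,
-- and for fixed γ the admissible u are K copies of the overlap of [b, b + L)
-- shifted by r γ with [b + c, b + c + L).  Hence
--     e(U, W) = K · tent L,   tent L = Σ_{γ ∈ A} (L - ∣ r γ - c ∣)₊,
-- and DISC₂ pins tent L to |A| K L² / (n - 1) up to a factor 1 ± δ.  The number
-- S of γ ∈ A with r γ ∈ [c - ℓ, c + ℓ) is sandwiched by tents:
--     d S + tent ℓ ≤ tent (ℓ + d),   tent ℓ ≤ d S + tent (ℓ - d),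
-- and combining the three discrepancy estimates gives the bound on ∣ S - 2ℓ|A|/m ∣.

open import Data.Nat using (ℕ)
open import Data.Fin using (Fin)
open import Defs

module FiniteSums where
  open import Data.Nat using (zero; suc; _+_; _*_; _≤_; _<_; z≤n; s≤s; _≟_)
  open import Data.Nat.Properties
    using (+-0-commutativeMonoid; +-*-semiring; +-mono-≤; +-identityʳ; *-identityʳ; *-zeroʳ)
  open import Data.Bool using (Bool; true; false; _∧_)
  open import Data.Fin using (zero; suc; toℕ)
  open import Data.Fin.Subset using (Subset; ∣_∣; _∈_)
  open import Data.Fin.Permutation using (permutation)
  open import Data.Vec as Vec using (lookup)
  open import Data.Vec.Properties using (lookup⇒[]=; []=⇒lookup)
  open import Data.Product using (_×_; _,_)
  open import Function using (_∘_; _⇔_; Equivalence)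
  open import Data.List as List using (allFin)
  import Data.List.Properties as List
  import Data.Nat.ListAction as ListAction
  open import Relation.Nullary using (Dec; yes; no; does)
  open import Relation.Nullary.Negation using (contradiction)
  open import Relation.Binary.PropositionalEquality
  import Algebra.Properties.CommutativeMonoid.Sum as CommutativeMonoidSum
  import Algebra.Properties.Semiring.Sum as SemiringSum

  open CommutativeMonoidSum +-0-commutativeMonoid public
    using (sum; sum-cong-≗; ∑-distrib-+; ∑-comm; sum-permute)
  open SemiringSum +-*-semiring public using (*-distribˡ-sum; *-distribʳ-sum)

  bit : Bool → ℕ
  bit true  = 1
  bit false = 0

  𝟙 : {P : Set} → Dec P → ℕ
  𝟙 p = bit (does p)

  does-true : ∀ {P : Set} (p : Dec P) → does p ≡ true → P
  does-true (yes x) _ = x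

  bit-∧-last : ∀ x y z → bit (x ∧ y ∧ z) ≡ bit z * bit (x ∧ y)
  bit-∧-last true  true  z = sym (*-identityʳ (bit z))
  bit-∧-last true  false z = sym (*-zeroʳ (bit z))
  bit-∧-last false y     z = sym (*-zeroʳ (bit z))

  𝟙-cong : ∀ {P Q : Set} (p : Dec P) (q : Dec Q) → (P → Q) → (Q → P) → 𝟙 p ≡ 𝟙 q
  𝟙-cong (yes _) (yes _) _ _ = refl
  𝟙-cong (yes x) (no ¬y) f _ = contradiction (f x) ¬y
  𝟙-cong (no ¬x) (yes y) _ g = contradiction (g y) ¬x
  𝟙-cong (no _)  (no _)  _ _ = refl

  sum-mono : ∀ {n} {f g : Fin n → ℕ} → (∀ i → f i ≤ g i) → sum f ≤ sum g
  sum-mono {zero}  _ = z≤n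
  sum-mono {suc n} f≤g = +-mono-≤ (f≤g zero) (sum-mono (f≤g ∘ suc))

  sum-zero : ∀ {n} (f : Fin n → ℕ) → (∀ i → f i ≡ 0) → sum f ≡ 0
  sum-zero {zero}  f _  = refl
  sum-zero {suc n} f f≡0 = cong₂ _+_ (f≡0 zero) (sum-zero (f ∘ suc) (f≡0 ∘ suc))

  sum-ones : ∀ n → sum {n} (λ _ → 1) ≡ n
  sum-ones zero    = refl
  sum-ones (suc n) = cong suc (sum-ones n)

  sum-reindex : ∀ {n} (f : Fin n → ℕ) (τ σ : Fin n → Fin n) →
    (∀ x → τ (σ x) ≡ x) → (∀ x → σ (τ x) ≡ x) → sum f ≡ sum (f ∘ τ)
  sum-reindex f τ σ τσ στ = sum-permute f (permutation τ σ τσ στ)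

  sum-delta : ∀ {m} (g : ℕ → ℕ) (x : ℕ) → x < m →
    sum {m} (λ κ → 𝟙 (toℕ κ ≟ x) * g (toℕ κ)) ≡ g x
  sum-delta {suc m} g zero    _ =
    trans (cong₂ _+_ (+-identityʳ (g 0)) (sum-zero {m} _ (λ _ → refl))) (+-identityʳ (g 0))
  sum-delta {suc m} g (suc x) (s≤s x<m) = sum-delta {m} (g ∘ suc) x x<m

  card≡sum : ∀ {n} (p : Subset n) → ∣ p ∣ ≡ sum (bit ∘ lookup p)
  card≡sum Vec.[]            = refl
  card≡sum (true Vec.∷ p)  = cong suc (card≡sum p)
  card≡sum (false Vec.∷ p) = card≡sum p

  card-conj : ∀ {n} (S A : Subset n) {P : Fin n → Set} (P? : ∀ γ → Dec (P γ)) →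
    (∀ γ → γ ∈ S ⇔ (γ ∈ A × P γ)) → ∣ S ∣ ≡ sum (λ γ → bit (lookup A γ) * 𝟙 (P? γ))
  card-conj S A P? S⇔ = trans (card≡sum S) (sum-cong-≗ pointwise)
    where
    pointwise : ∀ γ → bit (lookup S γ) ≡ bit (lookup A γ) * 𝟙 (P? γ)
    pointwise γ with lookup S γ in S∋γ
    ... | true with Equivalence.to (S⇔ γ) (lookup⇒[]= γ S S∋γ)
    ...   | A∋γ , Pγ rewrite []=⇒lookup A∋γ with P? γ
    ...     | yes _  = refl
    ...     | no ¬Pγ = contradiction Pγ ¬Pγ
    pointwise γ | false with lookup A γ in A∋γ | P? γ
    ... | true  | yes Pγ with trans (sym S∋γ) ([]=⇒lookup (Equivalence.from (S⇔ γ) (lookup⇒[]= γ A A∋γ , Pγ)))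
    ...   | ()
    pointwise γ | false | true  | no _ = refl
    pointwise γ | false | false | _    = refl

  listSum≡sum : ∀ {n} (f : Fin n → ℕ) → ListAction.sum (List.map f (allFin n)) ≡ sum f
  listSum≡sum {n} f = trans (cong ListAction.sum (List.map-tabulate (λ i → i) f)) (tabulated f)
    where
    tabulated : ∀ {k} (g : Fin k → ℕ) → ListAction.sum (List.tabulate g) ≡ sum g
    tabulated {zero}  g = refl
    tabulated {suc k} g = cong (g zero +_) (tabulated (g ∘ suc))

-- Counting integers in windows [x, y) ⊆ [0, m), and the "tent" function
-- L ∸ ∣ f - c ∣ measuring how much two windows of length L overlap.
module Windows where
  open import Data.Nat using (zero; suc; _+_; _*_; _∸_; _≤_; _<_; z≤n; s≤s; s<s; s≤s⁻¹; s<s⁻¹; ∣_-_∣)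
  open import Data.Nat.Properties
  open import Data.Nat.Tactic.RingSolver using (solve-∀)
  open import Data.Fin using (toℕ)
  open import Data.Product using (_×_; _,_; proj₁; proj₂)
  open import Relation.Nullary using (Dec; yes; no; ¬_)
  open import Relation.Nullary.Decidable using (_×-dec_)
  open import Relation.Binary.PropositionalEquality
  open FiniteSums

  Window : ℕ → ℕ → ℕ → Set
  Window x y j = x ≤ j × j < y

  window? : ∀ x y j → Dec (Window x y j)
  window? x y j = (x ≤? j) ×-dec (j <? y)

  count-window : ∀ m x y → y ≤ m → sum {m} (λ κ → 𝟙 (window? x y (toℕ κ))) ≡ y ∸ x
  count-window zero    x       zero    z≤n = sym (0∸n≡0 x)
  count-window (suc m) x       zero    _ =
    trans (sum-zero {suc m} _ (λ κ → 𝟙-cong (window? x 0 (toℕ κ)) (no λ ()) (λ w → n≮0 (proj₂ w)) λ ()))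
          (sym (0∸n≡0 x))
  count-window (suc m) zero    (suc y) (s≤s y≤m) = cong suc (trans
    (sum-cong-≗ {m} λ κ → 𝟙-cong (window? 0 (suc y) (suc (toℕ κ))) (window? 0 y (toℕ κ))
      (λ w → z≤n , s<s⁻¹ (proj₂ w)) (λ w → z≤n , s<s (proj₂ w)))
    (count-window m 0 y y≤m))
  count-window (suc m) (suc x) (suc y) (s≤s y≤m) = trans
    (sum-cong-≗ {m} λ κ → 𝟙-cong (window? (suc x) (suc y) (suc (toℕ κ))) (window? x y (toℕ κ))
      (λ w → s≤s⁻¹ (proj₁ w) , s<s⁻¹ (proj₂ w)) (λ w → s≤s (proj₁ w) , s<s (proj₂ w)))
    (count-window m x y y≤m)

  private
    +-<-∸ : ∀ f o j → j < o ∸ f → f + j < o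
    +-<-∸ zero    o       j j<o = j<o
    +-<-∸ (suc f) (suc o) j j<o = s≤s (+-<-∸ f o j j<o)

    ∸-<-+ : ∀ f o j → f + j < o → j < o ∸ f
    ∸-<-+ zero    o       j fj<o       = fj<o
    ∸-<-+ (suc f) (suc o) j (s≤s fj<o) = ∸-<-+ f o j fj<o

  Overlap : ℕ → ℕ → ℕ → ℕ → ℕ → Set
  Overlap a L c f j = Window a (a + L) j × Window (a + c) (a + c + L) (f + j)

  overlap? : ∀ a L c f j → Dec (Overlap a L c f j)
  overlap? a L c f j = window? a (a + L) j ×-dec window? (a + c) (a + c + L) (f + j)

  count-overlap : ∀ m a L c f → L ≤ c → a + c + L ≤ m →
    sum {m} (λ κ → 𝟙 (overlap? a L c f (toℕ κ))) ≡ L ∸ ∣ f - c ∣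
  count-overlap m a L c f L≤c acL≤m with f ≤? c
  ... | yes f≤c = begin
    sum {m} (λ κ → 𝟙 (overlap? a L c f (toℕ κ)))
      ≡⟨ sum-cong-≗ {m} (λ κ → 𝟙-cong (overlap? a L c f (toℕ κ)) (window? x (a + L) (toℕ κ)) to from) ⟩
    sum {m} (λ κ → 𝟙 (window? x (a + L) (toℕ κ)))
      ≡⟨ count-window m x (a + L) aL≤m ⟩
    a + L ∸ (a + (c ∸ f))
      ≡⟨ [m+n]∸[m+o]≡n∸o a L (c ∸ f) ⟩
    L ∸ (c ∸ f)
      ≡⟨ cong (L ∸_) (m≤n⇒∣m-n∣≡n∸m f≤c) ⟨
    L ∸ ∣ f - c ∣ ∎
    where
    open ≡-Reasoning
    x : ℕ
    x = a + (c ∸ f)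
    ac∸f≡x : a + c ∸ f ≡ x
    ac∸f≡x = +-∸-assoc a f≤c
    aL≤m : a + L ≤ m
    aL≤m = ≤-trans (≤-trans (+-monoʳ-≤ a L≤c) (m≤m+n (a + c) L)) acL≤m
    reassoc : ∀ a c L → a + c + L ≡ c + (a + L)
    reassoc = solve-∀
    to : ∀ {j} → Overlap a L c f j → Window x (a + L) j
    to {j} ((_ , j<aL) , (ac≤fj , _)) = subst (_≤ j) ac∸f≡x (m≤n+o⇒m∸n≤o (a + c) f ac≤fj) , j<aL
    from : ∀ {j} → Window x (a + L) j → Overlap a L c f j
    from {j} (x≤j , j<aL) =
      (≤-trans (m≤m+n a (c ∸ f)) x≤j , j<aL) ,
      ( subst (_≤ f + j) (trans (cong (_+ f) (sym ac∸f≡x)) (m∸n+n≡m (≤-trans f≤c (m≤n+m c a))))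
          (subst (x + f ≤_) (+-comm j f) (+-monoˡ-≤ f x≤j))
      , <-≤-trans (+-monoʳ-< f j<aL) (subst (f + (a + L) ≤_) (sym (reassoc a c L)) (+-monoˡ-≤ (a + L) f≤c)))
  ... | no f≰c = begin
    sum {m} (λ κ → 𝟙 (overlap? a L c f (toℕ κ)))
      ≡⟨ sum-cong-≗ {m} (λ κ → 𝟙-cong (overlap? a L c f (toℕ κ)) (window? a y (toℕ κ)) to from) ⟩
    sum {m} (λ κ → 𝟙 (window? a y (toℕ κ)))
      ≡⟨ count-window m a y (≤-trans (m∸n≤m (a + c + L) f) acL≤m) ⟩
    a + c + L ∸ f ∸ a
      ≡⟨ ∸-+-assoc (a + c + L) f a ⟩
    a + c + L ∸ (f + a)
      ≡⟨ cong (λ z → a + c + L ∸ (z + a)) (m+[n∸m]≡n c≤f) ⟨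
    a + c + L ∸ (c + (f ∸ c) + a)
      ≡⟨ cong (a + c + L ∸_) (reassoc a c (f ∸ c)) ⟩
    a + c + L ∸ (a + c + (f ∸ c))
      ≡⟨ [m+n]∸[m+o]≡n∸o (a + c) L (f ∸ c) ⟩
    L ∸ (f ∸ c)
      ≡⟨ cong (L ∸_) (m≤n⇒∣n-m∣≡n∸m c≤f) ⟨
    L ∸ ∣ f - c ∣ ∎
    where
    open ≡-Reasoning
    c≤f : c ≤ f
    c≤f = ≰⇒≥ f≰c
    y : ℕ
    y = a + c + L ∸ f
    reassoc : ∀ a c k → c + k + a ≡ a + c + k
    reassoc = solve-∀
    y≤aL : y ≤ a + L
    y≤aL = ≤-trans (∸-monoʳ-≤ (a + c + L) c≤f)
      (≤-reflexive (trans (cong (_∸ c) (swap a c L)) (m+n∸n≡m (a + L) c)))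
      where
      swap : ∀ a c L → a + c + L ≡ a + L + c
      swap = solve-∀
    to : ∀ {j} → Overlap a L c f j → Window a y j
    to {j} ((a≤j , _) , (_ , fj<acL)) = a≤j , ∸-<-+ f (a + c + L) j fj<acL
    from : ∀ {j} → Window a y j → Overlap a L c f j
    from {j} (a≤j , j<y) =
      (a≤j , <-≤-trans j<y y≤aL) ,
      (subst (_≤ f + j) (+-comm c a) (+-mono-≤ c≤f a≤j) , +-<-∸ f (a + c + L) j j<y)

  window⇒dist≤ : ∀ f c ℓ → Window (c ∸ ℓ) (c + ℓ) f → ∣ f - c ∣ ≤ ℓ
  window⇒dist≤ f c ℓ (c∸ℓ≤f , f<cℓ) with f ≤? c
  ... | yes f≤c = subst (_≤ ℓ) (sym (m≤n⇒∣m-n∣≡n∸m f≤c))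
    (m≤n+o⇒m∸n≤o c f (subst (c ≤_) (+-comm ℓ f) (≤-trans (m≤n+m∸n c ℓ) (+-monoʳ-≤ ℓ c∸ℓ≤f))))
  ... | no f≰c = subst (_≤ ℓ) (sym (m≤n⇒∣n-m∣≡n∸m (≰⇒≥ f≰c))) (m≤n+o⇒m∸n≤o f c (<⇒≤ f<cℓ))

  ¬window⇒dist≥ : ∀ f c ℓ → ¬ Window (c ∸ ℓ) (c + ℓ) f → ℓ ≤ ∣ f - c ∣
  ¬window⇒dist≥ f c ℓ ¬w with f <? c ∸ ℓ
  ... | yes f<c∸ℓ = subst (ℓ ≤_) (sym (m≤n⇒∣m-n∣≡n∸m (≤-trans (m≤n+m f ℓ) (<⇒≤ ℓf<c))))
                      (m+n≤o⇒m≤o∸n ℓ (<⇒≤ ℓf<c))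
    where
    ℓf<c : ℓ + f < c
    ℓf<c = +-<-∸ ℓ c f f<c∸ℓ
  ... | no f≮c∸ℓ = subst (ℓ ≤_) (sym (m≤n⇒∣n-m∣≡n∸m (≤-trans (m≤m+n c ℓ) cℓ≤f)))
                      (m+n≤o⇒m≤o∸n ℓ (subst (_≤ f) (+-comm c ℓ) cℓ≤f))
    where
    cℓ≤f : c + ℓ ≤ f
    cℓ≤f = ≮⇒≥ (λ f<cℓ → ¬w (≮⇒≥ f≮c∸ℓ , f<cℓ))

  tent-widen : ∀ {P : Set} (p : Dec P) ℓ d D → (P → D ≤ ℓ) → d * 𝟙 p + (ℓ ∸ D) ≤ (ℓ + d) ∸ D
  tent-widen (yes x) ℓ d D P⇒D≤ℓ = ≤-reflexive (begin
    d * 1 + (ℓ ∸ D) ≡⟨ cong (_+ (ℓ ∸ D)) (*-identityʳ d) ⟩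
    d + (ℓ ∸ D)     ≡⟨ +-comm d (ℓ ∸ D) ⟩
    ℓ ∸ D + d       ≡⟨ +-∸-comm d (P⇒D≤ℓ x) ⟨
    ℓ + d ∸ D       ∎)
    where open ≡-Reasoning
  tent-widen (no _)  ℓ d D _ = subst (_≤ ℓ + d ∸ D) (cong (_+ (ℓ ∸ D)) (sym (*-zeroʳ d)))
    (∸-monoˡ-≤ D (m≤m+n ℓ d))

  tent-narrow : ∀ {P : Set} (p : Dec P) ℓ d D → (¬ P → ℓ ≤ D) → ℓ ∸ D ≤ d * 𝟙 p + (ℓ ∸ d ∸ D)
  tent-narrow (yes _) ℓ d D _ = subst (ℓ ∸ D ≤_) (cong (_+ (ℓ ∸ d ∸ D)) (sym (*-identityʳ d)))
    (m≤n+o⇒m∸n≤o ℓ D (≤-trans (m≤n+m∸n ℓ (d + D)) (≤-reflexive (begin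
      d + D + (ℓ ∸ (d + D)) ≡⟨ cong (d + D +_) (∸-+-assoc ℓ d D) ⟨
      d + D + (ℓ ∸ d ∸ D)   ≡⟨ reassoc d D (ℓ ∸ d ∸ D) ⟩
      D + (d + (ℓ ∸ d ∸ D)) ∎))))
    where
    open ≡-Reasoning
    reassoc : ∀ d D k → d + D + k ≡ D + (d + k)
    reassoc = solve-∀
  tent-narrow (no ¬x) ℓ d D ¬P⇒ℓ≤D = ≤-trans (≤-reflexive (m≤n⇒m∸n≡0 (¬P⇒ℓ≤D ¬x))) z≤n

  tent : ∀ {n} (w f : Fin n → ℕ) (c L : ℕ) → ℕ
  tent w f c L = sum (λ γ → w γ * (L ∸ ∣ f γ - c ∣))

  hits : ∀ {n} (w f : Fin n → ℕ) (lo hi : ℕ) → ℕ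
  hits w f lo hi = sum (λ γ → w γ * 𝟙 (window? lo hi (f γ)))

  private
    combine : ∀ {n} (w g h : Fin n → ℕ) d →
      d * sum (λ γ → w γ * g γ) + sum (λ γ → w γ * h γ) ≡ sum (λ γ → w γ * (d * g γ + h γ))
    combine w g h d = begin
      d * sum (λ γ → w γ * g γ) + sum (λ γ → w γ * h γ)
        ≡⟨ cong (_+ sum (λ γ → w γ * h γ)) (*-distribˡ-sum d (λ γ → w γ * g γ)) ⟩
      sum (λ γ → d * (w γ * g γ)) + sum (λ γ → w γ * h γ)
        ≡⟨ ∑-distrib-+ (λ γ → d * (w γ * g γ)) (λ γ → w γ * h γ) ⟨
      sum (λ γ → d * (w γ * g γ) + w γ * h γ)
        ≡⟨ sum-cong-≗ (λ γ → factor (w γ) d (g γ) (h γ)) ⟩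
      sum (λ γ → w γ * (d * g γ + h γ)) ∎
      where
      open ≡-Reasoning
      factor : ∀ b d g h → d * (b * g) + b * h ≡ b * (d * g + h)
      factor = solve-∀

  tent-widen-sum : ∀ {n} (w f : Fin n → ℕ) c ℓ d →
    d * hits w f (c ∸ ℓ) (c + ℓ) + tent w f c ℓ ≤ tent w f c (ℓ + d)
  tent-widen-sum w f c ℓ d = subst (_≤ tent w f c (ℓ + d)) (sym (combine w _ _ d))
    (sum-mono λ γ → *-monoʳ-≤ (w γ)
      (tent-widen (window? (c ∸ ℓ) (c + ℓ) (f γ)) ℓ d ∣ f γ - c ∣ (window⇒dist≤ (f γ) c ℓ)))

  tent-narrow-sum : ∀ {n} (w f : Fin n → ℕ) c ℓ d →
    tent w f c ℓ ≤ d * hits w f (c ∸ ℓ) (c + ℓ) + tent w f c (ℓ ∸ d)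
  tent-narrow-sum w f c ℓ d = subst (tent w f c ℓ ≤_) (sym (combine w _ _ d))
    (sum-mono λ γ → *-monoʳ-≤ (w γ)
      (tent-narrow (window? (c ∸ ℓ) (c + ℓ) (f γ)) ℓ d ∣ f γ - c ∣ (¬window⇒dist≥ (f γ) c ℓ)))

module Residues where
  open import Data.Nat using (zero; suc; _+_; _*_; _∸_; _≤_; _<_)
  open import Data.Nat.Properties
  open import Data.Nat.Divisibility using (_∣_; divides)
  open import Data.Integer using (_⊖_; ∣_∣)
  open import Data.Integer.Properties using (∣⊖∣-≤; ∣m⊖n∣≡∣n⊖m∣)
  open import Data.Sum using (_⊎_; inj₁; inj₂)
  open import Data.Empty using (⊥-elim)
  open import Relation.Nullary using (yes; no)
  open import Relation.Binary.PropositionalEquality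

  multiple<2m : ∀ {m k} → k < m + m → m ∣ k → k ≡ 0 ⊎ k ≡ m
  multiple<2m _ (divides zero          k≡0)  = inj₁ k≡0
  multiple<2m {m} _ (divides (suc zero) k≡m) = inj₂ (trans k≡m (+-identityʳ m))
  multiple<2m {m} k<2m (divides (suc (suc q)) k≡) =
    ⊥-elim (<⇒≱ k<2m (subst (m + m ≤_) (sym k≡) (+-monoʳ-≤ m (m≤m+n m (q * m)))))

  congruent-below-2m : ∀ {m} x y → x < m → y < m + m → m ∣ ∣ x ⊖ y ∣ → y ≡ x ⊎ y ≡ x + m
  congruent-below-2m {m} x y x<m y<2m m∣x-y with x ≤? y
  ... | yes x≤y with multiple<2m (≤-<-trans (m∸n≤m y x) y<2m) (subst (m ∣_) (∣⊖∣-≤ x≤y) m∣x-y)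
  ...   | inj₁ y∸x≡0 = inj₁ (≤-antisym (m∸n≡0⇒m≤n y∸x≡0) x≤y)
  ...   | inj₂ y∸x≡m = inj₂ (trans (sym (m∸n+n≡m x≤y)) (trans (cong (_+ x) y∸x≡m) (+-comm m x)))
  congruent-below-2m {m} x y x<m y<2m m∣x-y | no x≰y
    with multiple<2m (≤-<-trans (m∸n≤m x y) (<-≤-trans x<m (m≤m+n m m)))
           (subst (m ∣_) (trans (∣m⊖n∣≡∣n⊖m∣ x y) (∣⊖∣-≤ (≰⇒≥ x≰y))) m∣x-y)
  ...   | inj₁ x∸y≡0 = inj₁ (≤-antisym (≰⇒≥ x≰y) (m∸n≡0⇒m≤n x∸y≡0))
  ...   | inj₂ x∸y≡m = ⊥-elim (<⇒≱ x<m (subst (_≤ x) x∸y≡m (m∸n≤m x y)))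

  congruent-below-m : ∀ {m} x y → x < m → y < m → m ∣ ∣ x ⊖ y ∣ → y ≡ x
  congruent-below-m {m} x y x<m y<m m∣x-y
    with congruent-below-2m x y x<m (<-≤-trans y<m (m≤m+n m m)) m∣x-y
  ... | inj₁ y≡x  = y≡x
  ... | inj₂ y≡xm = ⊥-elim (<⇒≱ y<m (subst (m ≤_) (sym y≡xm) (m≤n+m m x)))

module ZmodHomomorphism {n : ℕ} (Γ : FinAbGroup n) {m : ℕ} (ρ : Fin n → Fin m)
                        (hom : IsHomZmod Γ m ρ) where
  open import Data.Nat using (_+_; _*_; _∸_; _≤_; _<_; _≟_; ∣_-_∣)
  open import Data.Nat.Properties
  open import Data.Nat.Tactic.RingSolver using (solve-∀)
  open import Data.Bool using (Bool; true; false; _∧_)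
  open import Data.Vec as Vec using (lookup)
  open import Data.Vec.Properties using (lookup∘tabulate; []=⇒lookup)
  open import Data.List as List using (allFin)
  import Data.Nat.ListAction as ListAction
  open import Data.Fin.Subset using (Subset; ∣_∣)
  open import Relation.Nullary using (does)
  open import Relation.Nullary.Decidable using (_×-dec_)
  open import Data.Nat.Divisibility using (_∣_; _∣0)
  open import Data.Fin using (toℕ; fromℕ<)
  open import Data.Fin.Properties using (toℕ<n; toℕ-fromℕ<)
  open import Data.Integer as ℤ using (+_)
  open import Data.Integer.Properties using (m-n≡m⊖n; +-inverseʳ)
  open import Data.Product using (_×_; _,_; proj₁; proj₂)
  open import Data.Sum using (_⊎_; inj₁; inj₂)
  open import Data.Empty using (⊥-elim)
  open import Data.Fin.Subset using (_∈_)
  open import Data.Product.Function.NonDependent.Propositional using (_×-⇔_)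
  open import Function using (_∘_; _⇔_; mk⇔)
  import Function.Properties.Equivalence as ⇔
  open import Function.Definitions using (Surjective)
  open import Relation.Binary.PropositionalEquality
  open import Algebra.Structures using (IsAbelianGroup)
  open FinAbGroup Γ
  open IsAbelianGroup isAbelianGroup using (assoc; inverseˡ; inverseʳ; identityʳ)
  open FiniteSums
  open Windows
  open Residues

  r : Fin n → ℕ
  r γ = toℕ (ρ γ)

  r<m : ∀ γ → r γ < m
  r<m γ = toℕ<n (ρ γ)

  carry : ∀ x y → r x + r y ≡ r (x ⊕ y) ⊎ r x + r y ≡ r (x ⊕ y) + m
  carry x y = congruent-below-2m (r (x ⊕ y)) (r x + r y) (r<m (x ⊕ y)) (+-mono-< (r<m x) (r<m y))
    (subst (m ∣_) (cong ℤ.∣_∣ (m-n≡m⊖n (r (x ⊕ y)) (r x + r y))) (hom x y))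

  preimage⇔window : ∀ lo hi γ → hi ≤ m → InPreimage Γ m ρ (+ lo) (+ hi) γ ⇔ Window lo hi (r γ)
  preimage⇔window lo hi γ hi≤m = mk⇔ to from
    where
    to : InPreimage Γ m ρ (+ lo) (+ hi) γ → Window lo hi (r γ)
    to (+ f , ℤ.+≤+ lo≤f , ℤ.+<+ f<hi , m∣f-r) = subst (lo ≤_) f≡r lo≤f , subst (_< hi) f≡r f<hi
      where
      f≡r : f ≡ r γ
      f≡r = sym (congruent-below-m f (r γ) (<-≤-trans f<hi hi≤m) (r<m γ)
              (subst (m ∣_) (cong ℤ.∣_∣ (m-n≡m⊖n f (r γ))) m∣f-r))
    from : Window lo hi (r γ) → InPreimage Γ m ρ (+ lo) (+ hi) γ
    from (lo≤r , r<hi) = + r γ , ℤ.+≤+ lo≤r , ℤ.+<+ r<hi ,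
      subst (m ∣_) (sym (cong ℤ.∣_∣ (+-inverseʳ (+ r γ)))) (m ∣0)

  card-A∩preimage : ∀ (A S : Subset n) lo hi → hi ≤ m →
    (∀ γ → γ ∈ S ⇔ (γ ∈ A × InPreimage Γ m ρ (+ lo) (+ hi) γ)) → ∣ S ∣ ≡ hits (bit ∘ lookup A) r lo hi
  card-A∩preimage A S lo hi hi≤m S⇔ = card-conj S A (λ γ → window? lo hi (r γ))
    (λ γ → ⇔.trans (S⇔ γ) (⇔.refl ×-⇔ preimage⇔window lo hi γ hi≤m))

  ⊕-⊝-cancel : ∀ x c → (x ⊕ ⊝ c) ⊕ c ≡ x
  ⊕-⊝-cancel x c = trans (assoc x (⊝ c) c) (trans (cong (x ⊕_) (inverseˡ c)) (identityʳ x))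

  ⊕-⊕⊝-cancel : ∀ x c → (x ⊕ c) ⊕ ⊝ c ≡ x
  ⊕-⊕⊝-cancel x c = trans (assoc x c (⊝ c)) (trans (cong (x ⊕_) (inverseʳ c)) (identityʳ x))

  module Fibres (onto : Surjective _≡_ _≡_ ρ) where
    fibre : ℕ → ℕ
    fibre k = sum (λ u → 𝟙 (k ≟ r u))

    K : ℕ
    K = fibre 0

    -- Translating by an element c with residue k maps the fibre over 0 onto the fibre over k.
    fibre-constant : ∀ k → k < m → fibre k ≡ K
    fibre-constant k k<m = trans
      (sum-reindex _ (_⊕ c) (_⊕ ⊝ c) (λ x → ⊕-⊝-cancel x c) (λ x → ⊕-⊕⊝-cancel x c))
      (sum-cong-≗ λ u → 𝟙-cong (k ≟ r (u ⊕ c)) (0 ≟ r u) (to u) (from u))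
      where
      c : Fin n
      c = proj₁ (onto (fromℕ< k<m))
      rc≡k : r c ≡ k
      rc≡k = trans (cong toℕ (proj₂ (onto (fromℕ< k<m)) refl)) (toℕ-fromℕ< k<m)
      to : ∀ u → k ≡ r (u ⊕ c) → 0 ≡ r u
      to u k≡ with carry u c
      ... | inj₁ eq = sym (+-cancelʳ-≡ k (r u) 0 (trans (cong (λ z → r u + z) (sym rc≡k)) (trans eq (sym k≡))))
      ... | inj₂ eq = ⊥-elim (<⇒≢ (r<m u) (+-cancelʳ-≡ k (r u) m
              (trans (cong (λ z → r u + z) (sym rc≡k)) (trans eq (trans (cong (_+ m) (sym k≡)) (+-comm k m))))))
      from : ∀ u → 0 ≡ r u → k ≡ r (u ⊕ c)
      from u 0≡ with carry u c
      ... | inj₁ eq = trans (sym rc≡k) (trans (cong (_+ r c) 0≡) eq)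
      ... | inj₂ eq = ⊥-elim (<⇒≱ k<m (subst (m ≤_)
              (sym (trans (sym rc≡k) (trans (cong (_+ r c) 0≡) eq))) (m≤n+m m (r (u ⊕ c)))))

    sum-by-fibres : ∀ (g : ℕ → ℕ) → sum (λ u → g (r u)) ≡ K * sum {m} (λ κ → g (toℕ κ))
    sum-by-fibres g = begin
      sum (λ u → g (r u))
        ≡⟨ sum-cong-≗ (λ u → sum-delta {m} g (r u) (r<m u)) ⟨
      sum (λ u → sum {m} (λ κ → 𝟙 (toℕ κ ≟ r u) * g (toℕ κ)))
        ≡⟨ ∑-comm {n} {m} (λ u κ → 𝟙 (toℕ κ ≟ r u) * g (toℕ κ)) ⟩
      sum {m} (λ κ → sum (λ u → 𝟙 (toℕ κ ≟ r u) * g (toℕ κ)))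
        ≡⟨ sum-cong-≗ {m} (λ κ → *-distribʳ-sum (g (toℕ κ)) (λ u → 𝟙 (toℕ κ ≟ r u))) ⟨
      sum {m} (λ κ → fibre (toℕ κ) * g (toℕ κ))
        ≡⟨ sum-cong-≗ {m} (λ κ → cong (_* g (toℕ κ)) (fibre-constant (toℕ κ) (toℕ<n κ))) ⟩
      sum {m} (λ κ → K * g (toℕ κ))
        ≡⟨ *-distribˡ-sum {m} K (λ κ → g (toℕ κ)) ⟨
      K * sum {m} (λ κ → g (toℕ κ)) ∎
      where open ≡-Reasoning

    order≡K*m : n ≡ K * m
    order≡K*m = trans (sym (sum-ones n)) (trans (sum-by-fibres (λ _ → 1)) (cong (K *_) (sum-ones m)))

    window : ℕ → ℕ → Subset n
    window a L = Vec.tabulate (λ u → does (window? a (a + L) (r u)))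

    lookup-window : ∀ a L u → lookup (window a L) u ≡ does (window? a (a + L) (r u))
    lookup-window a L u = lookup∘tabulate _ u

    card-window : ∀ a L → a + L ≤ m → ∣ window a L ∣ ≡ K * L
    card-window a L aL≤m = begin
      ∣ window a L ∣                              ≡⟨ card≡sum (window a L) ⟩
      sum (λ u → bit (lookup (window a L) u))     ≡⟨ sum-cong-≗ (λ u → cong bit (lookup-window a L u)) ⟩
      sum (λ u → 𝟙 (window? a (a + L) (r u)))     ≡⟨ sum-by-fibres (λ j → 𝟙 (window? a (a + L) j)) ⟩
      K * sum {m} (λ κ → 𝟙 (window? a (a + L) (toℕ κ)))
        ≡⟨ cong (K *_) (trans (count-window m a (a + L) aL≤m) (m+n∸m≡n a L)) ⟩
      K * L                                       ∎
      where open ≡-Reasoning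

    windows-disjoint : ∀ a L b L′ → a + L ≤ b → Disjoint Γ (window a L) (window b L′)
    windows-disjoint a L b L′ aL≤b x x∈U x∈W = <⇒≱ (<-≤-trans (proj₂ in-U) aL≤b) (proj₁ in-W)
      where
      in-U : Window a (a + L) (r x)
      in-U = does-true (window? a (a + L) (r x)) (trans (sym (lookup-window a L x)) ([]=⇒lookup x∈U))
      in-W : Window b (b + L′) (r x)
      in-W = does-true (window? b (b + L′) (r x)) (trans (sym (lookup-window b L′ x)) ([]=⇒lookup x∈W))

    -- Edges of the Cayley graph G(Γ, A) between the windows U = ρ⁻¹[a, a + L) and
    -- W = ρ⁻¹[a + c, a + c + L): writing w = γ ⊕ u, the pair (u, w) is an edge iff
    -- γ ∈ A, and for fixed γ the admissible u form K copies of the overlap of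
    -- [a, a + L) shifted by r γ with [a + c, a + c + L).  Hence e(U, W) = K · tent.
    module WindowEdges (A : Subset n) (a L c : ℕ) (L≤c : L ≤ c) (acL≤m : a + c + L ≤ m) where
      U W : Subset n
      U = window a L
      W = window (a + c) L

      weight : Fin n → ℕ
      weight γ = bit (lookup A γ)

      -- u ∈ U and γ ⊕ u ∈ W exactly when r u is in the overlap for the shift r γ:
      -- a carry would force r (γ ⊕ u) < r u, impossible as W lies above U.
      shift-overlap : ∀ γ u →
        Window a (a + L) (r u) × Window (a + c) (a + c + L) (r (γ ⊕ u)) → Overlap a L c (r γ) (r u)
      shift-overlap γ u (in-U , in-W) with carry γ u
      ... | inj₁ eq = in-U , subst (Window (a + c) (a + c + L)) (sym eq) in-W
      ... | inj₂ eq = ⊥-elim (<-irrefl refl (≤-<-trans (proj₁ in-W) (<-≤-trans r[γ⊕u]<r[u]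
              (<⇒≤ (<-≤-trans (proj₂ in-U) (+-monoʳ-≤ a L≤c))))))
        where
        r[γ⊕u]<r[u] : r (γ ⊕ u) < r u
        r[γ⊕u]<r[u] = +-cancelʳ-< m (r (γ ⊕ u)) (r u)
          (subst (_< r u + m) eq (subst (r γ + r u <_) (+-comm m (r u)) (+-monoˡ-< (r u) (r<m γ))))

      overlap-shift : ∀ γ u →
        Overlap a L c (r γ) (r u) → Window a (a + L) (r u) × Window (a + c) (a + c + L) (r (γ ⊕ u))
      overlap-shift γ u (in-U , in-W) with carry γ u
      ... | inj₁ eq = in-U , subst (Window (a + c) (a + c + L)) eq in-W
      ... | inj₂ eq = ⊥-elim (<-irrefl refl (<-≤-trans (proj₂ in-W)
              (≤-trans acL≤m (subst (m ≤_) (sym eq) (m≤n+m m (r (γ ⊕ u)))))))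

      in-U×W : ∀ γ u → bit (lookup U u ∧ lookup W (γ ⊕ u)) ≡ 𝟙 (overlap? a L c (r γ) (r u))
      in-U×W γ u = trans
        (cong₂ (λ x y → bit (x ∧ y)) (lookup-window a L u) (lookup-window (a + c) L (γ ⊕ u)))
        (𝟙-cong (window? a (a + L) (r u) ×-dec window? (a + c) (a + c + L) (r (γ ⊕ u)))
                (overlap? a L c (r γ) (r u)) (shift-overlap γ u) (overlap-shift γ u))

      edges-with-difference : ∀ γ →
        sum (λ u → bit (lookup U u ∧ lookup W (γ ⊕ u) ∧ lookup A γ)) ≡ K * (weight γ * (L ∸ ∣ r γ - c ∣))
      edges-with-difference γ = begin
        sum (λ u → bit (lookup U u ∧ lookup W (γ ⊕ u) ∧ lookup A γ))
          ≡⟨ sum-cong-≗ (λ u → trans (bit-∧-last (lookup U u) (lookup W (γ ⊕ u)) (lookup A γ))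
                                     (cong (weight γ *_) (in-U×W γ u))) ⟩
        sum (λ u → weight γ * 𝟙 (overlap? a L c (r γ) (r u)))
          ≡⟨ *-distribˡ-sum (weight γ) (λ u → 𝟙 (overlap? a L c (r γ) (r u))) ⟨
        weight γ * sum (λ u → 𝟙 (overlap? a L c (r γ) (r u)))
          ≡⟨ cong (weight γ *_) (sum-by-fibres (λ j → 𝟙 (overlap? a L c (r γ) j))) ⟩
        weight γ * (K * sum {m} (λ κ → 𝟙 (overlap? a L c (r γ) (toℕ κ))))
          ≡⟨ cong (λ z → weight γ * (K * z)) (count-overlap m a L c (r γ) L≤c acL≤m) ⟩
        weight γ * (K * (L ∸ ∣ r γ - c ∣))
          ≡⟨ *-comm-middle (weight γ) K (L ∸ ∣ r γ - c ∣) ⟩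
        K * (weight γ * (L ∸ ∣ r γ - c ∣)) ∎
        where
        open ≡-Reasoning
        *-comm-middle : ∀ x y z → x * (y * z) ≡ y * (x * z)
        *-comm-middle = solve-∀

      b2n≡bit : ∀ x → b2n Γ x ≡ bit x
      b2n≡bit true  = refl
      b2n≡bit false = refl

      edges : eBetween Γ A U W ≡ K * tent weight r c L
      edges = begin
        eBetween Γ A U W
          ≡⟨ listSum≡sum {n} _ ⟩
        sum (λ u → ListAction.sum (List.map (λ w → b2n Γ (edge u w)) (allFin n)))
          ≡⟨ sum-cong-≗ {n} (λ u → trans (listSum≡sum {n} _) (sum-cong-≗ {n} λ w → b2n≡bit (edge u w))) ⟩
        sum (λ u → sum (λ w → bit (edge u w)))
          ≡⟨ sum-cong-≗ {n} (λ u →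
               sum-reindex _ (_⊕ u) (_⊕ ⊝ u) (λ w → ⊕-⊝-cancel w u) (λ γ → ⊕-⊕⊝-cancel γ u)) ⟩
        sum (λ u → sum (λ γ → bit (edge u (γ ⊕ u))))
          ≡⟨ sum-cong-≗ {n} (λ u → sum-cong-≗ {n} λ γ →
               cong (λ z → bit (lookup U u ∧ lookup W (γ ⊕ u) ∧ lookup A z)) (⊕-⊕⊝-cancel γ u)) ⟩
        sum (λ u → sum (λ γ → bit (lookup U u ∧ lookup W (γ ⊕ u) ∧ lookup A γ)))
          ≡⟨ ∑-comm {n} {n} (λ u γ → bit (lookup U u ∧ lookup W (γ ⊕ u) ∧ lookup A γ)) ⟩
        sum (λ γ → sum (λ u → bit (lookup U u ∧ lookup W (γ ⊕ u) ∧ lookup A γ)))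
          ≡⟨ sum-cong-≗ edges-with-difference ⟩
        sum (λ γ → K * (weight γ * (L ∸ ∣ r γ - c ∣)))
          ≡⟨ *-distribˡ-sum K (λ γ → weight γ * (L ∸ ∣ r γ - c ∣)) ⟨
        K * tent weight r c L ∎
        where
        open ≡-Reasoning
        edge : Fin n → Fin n → Bool
        edge u w = lookup U u ∧ lookup W w ∧ lookup A (w ⊕ ⊝ u)

module Pairs where
  open import Data.Nat using (zero; suc; _+_; _*_; _∸_)
  open import Data.Nat.Properties using (*-distribʳ-+)
  open import Data.Nat.Combinatorics using (_C_; nCk+nC[k+1]≡[n+1]C[k+1]; nC1≡n)
  open import Data.Nat.Tactic.RingSolver using (solve-∀)
  open import Relation.Binary.PropositionalEquality

  choose2*2 : ∀ n → (n C 2) * 2 ≡ n * (n ∸ 1)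
  choose2*2 zero          = refl
  choose2*2 (suc zero)    = refl
  choose2*2 (suc (suc k)) = begin
    (suc (suc k) C 2) * 2               ≡⟨ cong (_* 2) (nCk+nC[k+1]≡[n+1]C[k+1] (suc k) 1) ⟨
    ((suc k C 1) + (suc k C 2)) * 2     ≡⟨ cong (λ z → (z + (suc k C 2)) * 2) (nC1≡n (suc k)) ⟩
    (suc k + (suc k C 2)) * 2           ≡⟨ *-distribʳ-+ 2 (suc k) (suc k C 2) ⟩
    suc k * 2 + (suc k C 2) * 2         ≡⟨ cong (suc k * 2 +_) (choose2*2 (suc k)) ⟩
    suc k * 2 + suc k * k               ≡⟨ collect k ⟩
    suc (suc k) * suc k                 ∎
    where
    open ≡-Reasoning
    collect : ∀ k → suc k * 2 + suc k * k ≡ suc (suc k) * suc k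
    collect = solve-∀

open import Data.Nat as ℕ using (ℕ; NonZero)
open import Data.Integer as ℤ using (+_)
open import Data.Rational as ℚ using (ℚ; _/_; 0ℚ; 1ℚ; ½; _≤_; _<_; _*_; _+_; _-_; ∣_∣)
open import Data.Fin.Subset using (Subset; _∈_)
open import Data.Product using (_×_; _,_; proj₁; proj₂)
open import Data.Empty using (⊥)
open import Function using (_⇔_)
import Data.Nat.Properties as ℕP
import Data.Integer.Properties as ℤP
open import Function.Definitions using (Surjective)
open import Relation.Binary.PropositionalEquality using (_≡_; refl; sym; trans; cong; cong₂; subst; subst₂)

module RationalFacts where
  open import Data.Nat using (suc)
  open import Data.Rational using (mkℚ; -_; *≤*; *<*; nonNegative; positive)
  open import Data.Rational.Properties
  import Data.Rational.Unnormalised as ℚᵘ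
  import Data.Rational.Unnormalised.Properties as ℚᵘ
  import Data.Nat.Coprimality as Coprime
  open import Data.Rational.Solver using (module +-*-Solver)
  open +-*-Solver using (solve; _:+_; _:-_; _:=_)
  open import Data.Sum using (inj₁; inj₂)

  private
    ι : ℕ → ℚ
    ι a = mkℚ (+ a) 0 (Coprime.sym (Coprime.1-coprimeTo a))

    ⟦⟧≡ι : ∀ a → ⟦ a ⟧ ≡ ι a
    ⟦⟧≡ι a = normalize-coprime (Coprime.sym (Coprime.1-coprimeTo a))

  ⟦+⟧ : ∀ a b → ⟦ a ℕ.+ b ⟧ ≡ ⟦ a ⟧ + ⟦ b ⟧
  ⟦+⟧ a b = sym (trans (cong₂ _+_ (⟦⟧≡ι a) (⟦⟧≡ι b))
    (cong (_/ 1) (cong₂ ℤ._+_ (ℤP.*-identityʳ (+ a)) (ℤP.*-identityʳ (+ b)))))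

  ⟦*⟧ : ∀ a b → ⟦ a ℕ.* b ⟧ ≡ ⟦ a ⟧ * ⟦ b ⟧
  ⟦*⟧ a b = sym (trans (cong₂ _*_ (⟦⟧≡ι a) (⟦⟧≡ι b)) (cong (_/ 1) (sym (ℤP.pos-* a b))))

  ⟦∸⟧ : ∀ a b → b ℕ.≤ a → ⟦ a ℕ.∸ b ⟧ ≡ ⟦ a ⟧ - ⟦ b ⟧
  ⟦∸⟧ a b b≤a = trans (solve 2 (λ x y → x := x :+ y :- y) refl ⟦ a ℕ.∸ b ⟧ ⟦ b ⟧)
    (cong (_- ⟦ b ⟧) (trans (sym (⟦+⟧ (a ℕ.∸ b) b)) (cong ⟦_⟧ (ℕP.m∸n+n≡m b≤a))))

  ⟦≤⟧ : ∀ {a b} → a ℕ.≤ b → ⟦ a ⟧ ≤ ⟦ b ⟧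
  ⟦≤⟧ {a} {b} a≤b = subst₂ _≤_ (sym (⟦⟧≡ι a)) (sym (⟦⟧≡ι b))
    (*≤* (subst₂ ℤ._≤_ (sym (ℤP.*-identityʳ (+ a))) (sym (ℤP.*-identityʳ (+ b))) (ℤ.+≤+ a≤b)))

  ⟦≤⟧⁻¹ : ∀ {a b} → ⟦ a ⟧ ≤ ⟦ b ⟧ → a ℕ.≤ b
  ⟦≤⟧⁻¹ {a} {b} p with subst₂ _≤_ (⟦⟧≡ι a) (⟦⟧≡ι b) p
  ... | *≤* q with subst₂ ℤ._≤_ (ℤP.*-identityʳ (+ a)) (ℤP.*-identityʳ (+ b)) q
  ... | ℤ.+≤+ a≤b = a≤b

  ⟦<⟧ : ∀ {a b} → a ℕ.< b → ⟦ a ⟧ < ⟦ b ⟧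
  ⟦<⟧ {a} {b} a<b = subst₂ _<_ (sym (⟦⟧≡ι a)) (sym (⟦⟧≡ι b))
    (*<* (subst₂ ℤ._<_ (sym (ℤP.*-identityʳ (+ a))) (sym (ℤP.*-identityʳ (+ b))) (ℤ.+<+ a<b)))

  0≤⟦⟧ : ∀ a → 0ℚ ≤ ⟦ a ⟧
  0≤⟦⟧ a = ⟦≤⟧ {0} {a} ℕ.z≤n

  /-*-cancel : ∀ a b .{{_ : NonZero b}} → (+ a / b) * ⟦ b ⟧ ≡ ⟦ a ⟧
  /-*-cancel a (suc b) = toℚᵘ-injective (ℚᵘ.≃-trans (toℚᵘ-homo-* (+ a / suc b) ⟦ suc b ⟧)
    (ℚᵘ.≃-trans (ℚᵘ.*-cong (toℚᵘ-fromℚᵘ (ℚᵘ.mkℚᵘ (+ a) b)) (toℚᵘ-cong (⟦⟧≡ι (suc b))))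
      (ℚᵘ.≃-trans (ℚᵘ.*≡* cross) (toℚᵘ-cong (sym (⟦⟧≡ι a))))))
    where
    cross : (+ a ℤ.* + suc b) ℤ.* + 1 ≡ + a ℤ.* + suc (b ℕ.* 1)
    cross = trans (ℤP.*-identityʳ _) (cong (λ z → + a ℤ.* + suc z) (sym (ℕP.*-identityʳ b)))

  ⟦⟧≤/⇒*≤ : ∀ a b k .{{_ : NonZero k}} → ⟦ a ⟧ ≤ + b / k → a ℕ.* k ℕ.≤ b
  ⟦⟧≤/⇒*≤ a b k a≤b/k = ⟦≤⟧⁻¹ (subst₂ _≤_ (sym (⟦*⟧ a k)) (/-*-cancel b k)
    (*-monoʳ-≤-nonNeg ⟦ k ⟧ {{nonNegative (0≤⟦⟧ k)}} a≤b/k))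

  ≤-⇒+≤ : ∀ {x y z} → x ≤ y - z → x + z ≤ y
  ≤-⇒+≤ {x} {y} {z} x≤y-z = subst (x + z ≤_) (solve 2 (λ y z → y :- z :+ z := y) refl y z) (+-monoˡ-≤ z x≤y-z)

  ≤-*ʳ : ∀ {a b} c → 0ℚ ≤ c → a ≤ b → a * c ≤ b * c
  ≤-*ʳ c 0≤c = *-monoʳ-≤-nonNeg c {{nonNegative 0≤c}}

  ≤-*ˡ : ∀ {a b} c → 0ℚ ≤ c → a ≤ b → c * a ≤ c * b
  ≤-*ˡ c 0≤c = *-monoˡ-≤-nonNeg c {{nonNegative 0≤c}}

  ≤-cancel-*ʳ : ∀ {a b} c → 0ℚ < c → a * c ≤ b * c → a ≤ b
  ≤-cancel-*ʳ c 0<c = *-cancelʳ-≤-pos c {{positive 0<c}}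

  0≤-* : ∀ {a b} → 0ℚ ≤ a → 0ℚ ≤ b → 0ℚ ≤ a * b
  0≤-* {a} {b} 0≤a 0≤b = subst (_≤ a * b) (*-zeroˡ b) (≤-*ʳ b 0≤b 0≤a)

  0<-* : ∀ {a b} → 0ℚ < a → 0ℚ < b → 0ℚ < a * b
  0<-* {a} {b} 0<a 0<b = subst (_< a * b) (*-zeroˡ b) (*-monoˡ-<-pos b {{positive 0<b}} 0<a)

  0≤-+ : ∀ {a b} → 0ℚ ≤ a → 0ℚ ≤ b → 0ℚ ≤ a + b
  0≤-+ = +-mono-≤

  0≤-⇒≤ : ∀ {a b} → 0ℚ ≤ b - a → a ≤ b
  0≤-⇒≤ {a} {b} 0≤b-a = subst₂ _≤_ (+-identityˡ a) (solve 2 (λ a b → b :- a :+ a := b) refl a b)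
    (+-monoˡ-≤ a 0≤b-a)

  ≤⇒0≤- : ∀ {a b} → a ≤ b → 0ℚ ≤ b - a
  ≤⇒0≤- {a} {b} a≤b = subst (_≤ b - a) (+-inverseʳ a) (+-monoˡ-≤ (- a) a≤b)

  -‿mono-≤ : ∀ {a b c d} → a ≤ b → c ≤ d → a - d ≤ b - c
  -‿mono-≤ a≤b c≤d = +-mono-≤ a≤b (neg-antimono-≤ c≤d)

  ∣∣≤ : ∀ {x y} → x ≤ y → - x ≤ y → ∣ x ∣ ≤ y
  ∣∣≤ {x} {y} x≤y -x≤y with ∣p∣≡p∨∣p∣≡-p x
  ... | inj₁ ∣x∣≡x  = subst (_≤ y) (sym ∣x∣≡x) x≤y
  ... | inj₂ ∣x∣≡-x = subst (_≤ y) (sym ∣x∣≡-x) -x≤y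

-- Read S as the number of hits,
-- E₋, E, E₊ as the tents of half-width L - D, L, L + D, q = n - 1, N = n,
-- K = n/m, α = a/m with a = |A|, and β = 2/D.  The tent sandwich brackets D·S
-- between E - E₋ and E₊ - E, and discrepancy pins each tent of half-width L′
-- to a K L′² / q up to a factor 1 ± δ; with N ≤ (1 + δ/2) q this yields
--   ∣ S - 2 L α ∣ ≤ α (D + β δ ((L + D)² + L²)).
module Estimate
  (δ a M D L S q N K E₊ E E₋ α β : ℚ)
  (0<δ : 0ℚ < δ) (δ≤1 : δ ≤ 1ℚ) (0≤a : 0ℚ ≤ a) (0<M : 0ℚ < M) (0<D : 0ℚ < D)
  (0≤L : 0ℚ ≤ L) (0≤S : 0ℚ ≤ S) (0<q : 0ℚ < q) (q≤N : q ≤ N) (N≤q : N ≤ (1ℚ + δ * ½) * q)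
  (MK≡N : M * K ≡ N) (αM≡a : α * M ≡ a) (βD≡2 : β * D ≡ 1ℚ + 1ℚ)
  (widen : D * S + E ≤ E₊) (narrow : E ≤ D * S + E₋)
  (E-lower : (1ℚ - δ) * (a * (L * L) * K) ≤ E * q)
  (E₊-upper : E₊ * q ≤ (1ℚ + δ) * (a * ((L + D) * (L + D)) * K))
  (E₋-upper : E₋ * q ≤ (1ℚ + δ) * (a * ((L - D) * (L - D)) * K)) where

  open import Data.Rational using (-_)
  open import Data.Rational.Properties
    using (≤-trans; ≤-refl; <⇒≤; ≤-total; +-monoˡ-≤; ≤ᵇ⇒≤; module ≤-Reasoning)
  open import Data.Rational.Solver using (module +-*-Solver)
  open +-*-Solver using (solve; _:+_; _:*_; _:-_; :-_; _:=_; con)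
  open import Data.Sum using (inj₁; inj₂)
  open import Data.Unit using (tt)
  open RationalFacts
  open ≤-Reasoning

  two : ℚ
  two = 1ℚ + 1ℚ

  Y : ℚ
  Y = (L + D) * (L + D) + L * L

  0≤δ : 0ℚ ≤ δ
  0≤δ = <⇒≤ 0<δ

  0≤D : 0ℚ ≤ D
  0≤D = <⇒≤ 0<D

  0≤M : 0ℚ ≤ M
  0≤M = <⇒≤ 0<M

  0≤q : 0ℚ ≤ q
  0≤q = <⇒≤ 0<q

  0≤L² : 0ℚ ≤ L * L
  0≤L² = 0≤-* 0≤L 0≤L

  0≤Y : 0ℚ ≤ Y
  0≤Y = 0≤-+ (0≤-* (0≤-+ 0≤L 0≤D) (0≤-+ 0≤L 0≤D)) 0≤L²

  -- Both one-sided bounds, multiplied by D M, have the same right-hand side.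
  scaled-bound : a * (D * D + two * δ * Y) ≡ α * (D + β * δ * Y) * (D * M)
  scaled-bound = begin-equality
    a * (D * D + two * δ * Y)           ≡⟨ cong (λ w → w * (D * D + two * δ * Y)) αM≡a ⟨
    α * M * (D * D + two * δ * Y)       ≡⟨ cong (λ w → α * M * (D * D + w * δ * Y)) βD≡2 ⟨
    α * M * (D * D + β * D * δ * Y)
      ≡⟨ solve 6 (λ α M D β δ Y → α :* M :* (D :* D :+ β :* D :* δ :* Y)
                                  := α :* (D :+ β :* δ :* Y) :* (D :* M)) refl α M D β δ Y ⟩
    α * (D + β * δ * Y) * (D * M)       ∎

  X₊ : ℚ
  X₊ = (L + D) * (L + D) - L * L

  0≤X₊ : 0ℚ ≤ X₊
  0≤X₊ = subst (0ℚ ≤_) (solve 2 (λ L D → D :* (L :+ L :+ D) := (L :+ D) :* (L :+ D) :- L :* L) refl L D)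
    (0≤-* 0≤D (0≤-+ (0≤-+ 0≤L 0≤L) 0≤D))

  -- The slack 1 + δ/2 from N ≤ (1 + δ/2) q is absorbed by doubling δ.
  absorb-slack : (1ℚ + δ * ½) * (X₊ + δ * Y) ≤ X₊ + two * δ * Y
  absorb-slack = 0≤-⇒≤ (subst (0ℚ ≤_)
    (solve 3 (λ δ L D →
        δ :* con ½ :* ((L :* L :+ L :* L) :+ (con 1ℚ :- δ) :* ((L :+ D) :* (L :+ D) :+ L :* L))
      := (((L :+ D) :* (L :+ D) :- L :* L) :+ (con 1ℚ :+ con 1ℚ) :* δ :* ((L :+ D) :* (L :+ D) :+ L :* L))
         :- (con 1ℚ :+ δ :* con ½) :* (((L :+ D) :* (L :+ D) :- L :* L) :+ δ :* ((L :+ D) :* (L :+ D) :+ L :* L))) refl δ L D)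
    (0≤-* (0≤-* 0≤δ (≤ᵇ⇒≤ tt)) (0≤-+ (0≤-+ 0≤L² 0≤L²) (0≤-* (≤⇒0≤- δ≤1) 0≤Y))))

  DMS≤ : D * M * S ≤ a * (X₊ + two * δ * Y)
  DMS≤ = ≤-cancel-*ʳ q 0<q (begin
    D * M * S * q
      ≡⟨ solve 4 (λ D M S q → D :* M :* S :* q := M :* (D :* S :* q)) refl D M S q ⟩
    M * (D * S * q)
      ≤⟨ ≤-*ˡ M 0≤M (≤-*ʳ q 0≤q gap) ⟩
    M * ((E₊ - E) * q)
      ≤⟨ ≤-*ˡ M 0≤M disc ⟩
    M * (a * K * (X₊ + δ * Y))
      ≡⟨ solve 4 (λ M a K Z → M :* (a :* K :* Z) := a :* (M :* K) :* Z) refl M a K (X₊ + δ * Y) ⟩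
    a * (M * K) * (X₊ + δ * Y)
      ≡⟨ cong (λ w → a * w * (X₊ + δ * Y)) MK≡N ⟩
    a * N * (X₊ + δ * Y)
      ≤⟨ ≤-*ʳ (X₊ + δ * Y) (0≤-+ 0≤X₊ (0≤-* 0≤δ 0≤Y)) (≤-*ˡ a 0≤a N≤q) ⟩
    a * ((1ℚ + δ * ½) * q) * (X₊ + δ * Y)
      ≡⟨ solve 4 (λ a c q Z → a :* (c :* q) :* Z := a :* (c :* Z) :* q) refl a (1ℚ + δ * ½) q (X₊ + δ * Y) ⟩
    a * ((1ℚ + δ * ½) * (X₊ + δ * Y)) * q
      ≤⟨ ≤-*ʳ q 0≤q (≤-*ˡ a 0≤a absorb-slack) ⟩
    a * (X₊ + two * δ * Y) * q ∎)
    where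
    gap : D * S ≤ E₊ - E
    gap = begin
      D * S         ≡⟨ solve 2 (λ x e → x := x :+ e :- e) refl (D * S) E ⟩
      D * S + E - E ≤⟨ +-monoˡ-≤ (- E) widen ⟩
      E₊ - E        ∎
    disc : (E₊ - E) * q ≤ a * K * (X₊ + δ * Y)
    disc = begin
      (E₊ - E) * q
        ≡⟨ solve 3 (λ x y q → (x :- y) :* q := x :* q :- y :* q) refl E₊ E q ⟩
      E₊ * q - E * q
        ≤⟨ -‿mono-≤ E₊-upper E-lower ⟩
      (1ℚ + δ) * (a * ((L + D) * (L + D)) * K) - (1ℚ - δ) * (a * (L * L) * K)
        ≡⟨ solve 5 (λ δ a L D K →
             (con 1ℚ :+ δ) :* (a :* ((L :+ D) :* (L :+ D)) :* K) :- (con 1ℚ :- δ) :* (a :* (L :* L) :* K)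
             := a :* K :* (((L :+ D) :* (L :+ D) :- L :* L) :+ δ :* ((L :+ D) :* (L :+ D) :+ L :* L)))
             refl δ a L D K ⟩
      a * K * (X₊ + δ * Y) ∎

  upper : S - two * L * α ≤ α * (D + β * δ * Y)
  upper = ≤-cancel-*ʳ (D * M) (0<-* 0<D 0<M) (begin
    (S - two * L * α) * (D * M)
      ≡⟨ solve 6 (λ S t L α D M → (S :- t :* L :* α) :* (D :* M) := D :* M :* S :- t :* L :* D :* (α :* M))
           refl S two L α D M ⟩
    D * M * S - two * L * D * (α * M)
      ≡⟨ cong (λ w → D * M * S - two * L * D * w) αM≡a ⟩
    D * M * S - two * L * D * a
      ≤⟨ +-monoˡ-≤ (- (two * L * D * a)) DMS≤ ⟩
    a * (X₊ + two * δ * Y) - two * L * D * a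
      ≡⟨ solve 4 (λ a L D δ →
           a :* (((L :+ D) :* (L :+ D) :- L :* L) :+ (con 1ℚ :+ con 1ℚ) :* δ :* ((L :+ D) :* (L :+ D) :+ L :* L))
             :- (con 1ℚ :+ con 1ℚ) :* L :* D :* a
           := a :* (D :* D :+ (con 1ℚ :+ con 1ℚ) :* δ :* ((L :+ D) :* (L :+ D) :+ L :* L))) refl a L D δ ⟩
    a * (D * D + two * δ * Y)
      ≡⟨ scaled-bound ⟩
    α * (D + β * δ * Y) * (D * M) ∎)

  X₋ Y₋ : ℚ
  X₋ = L * L - (L - D) * (L - D)
  Y₋ = L * L + (L - D) * (L - D)

  R : ℚ
  R = a * (X₋ - two * δ * Y)

  R≤DMS : R ≤ D * M * S
  R≤DMS with ≤-total R 0ℚ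
  ... | inj₁ R≤0 = ≤-trans R≤0 (0≤-* (0≤-* 0≤D 0≤M) 0≤S)
  ... | inj₂ 0≤R = ≤-cancel-*ʳ q 0<q (begin
    R * q
      ≤⟨ ≤-*ʳ q 0≤q R≤B ⟩
    B * q
      ≤⟨ ≤-*ˡ B (≤-trans 0≤R R≤B) q≤N ⟩
    B * N
      ≡⟨ cong (B *_) MK≡N ⟨
    B * (M * K)
      ≡⟨ solve 4 (λ a W M K → a :* W :* (M :* K) := M :* (a :* K :* W)) refl a (X₋ - δ * Y₋) M K ⟩
    M * (a * K * (X₋ - δ * Y₋))
      ≤⟨ ≤-*ˡ M 0≤M (≤-trans disc (≤-*ʳ q 0≤q gap)) ⟩
    M * (D * S * q)
      ≡⟨ solve 4 (λ D M S q → M :* (D :* S :* q) := D :* M :* S :* q) refl D M S q ⟩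
    D * M * S * q ∎)
    where
    B : ℚ
    B = a * (X₋ - δ * Y₋)
    R≤B : R ≤ B
    R≤B = ≤-*ˡ a 0≤a (0≤-⇒≤ (subst (0ℚ ≤_)
      (solve 3 (λ δ L D →
          δ :* ((L :* L :+ L :* L) :+ D :* (L :+ L :+ L :+ L :+ L :+ L :+ D))
        := ((L :* L :- (L :- D) :* (L :- D)) :- δ :* (L :* L :+ (L :- D) :* (L :- D)))
           :- ((L :* L :- (L :- D) :* (L :- D)) :- (con 1ℚ :+ con 1ℚ) :* δ :* ((L :+ D) :* (L :+ D) :+ L :* L)))
        refl δ L D)
      (0≤-* 0≤δ (0≤-+ (0≤-+ 0≤L² 0≤L²) (0≤-* 0≤D six-L+D)))))
      where
      six-L+D : 0ℚ ≤ L + L + L + L + L + L + D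
      six-L+D = 0≤-+ (0≤-+ (0≤-+ (0≤-+ (0≤-+ (0≤-+ 0≤L 0≤L) 0≤L) 0≤L) 0≤L) 0≤L) 0≤D
    gap : E - E₋ ≤ D * S
    gap = begin
      E - E₋          ≤⟨ +-monoˡ-≤ (- E₋) narrow ⟩
      D * S + E₋ - E₋ ≡⟨ solve 2 (λ x e → x :+ e :- e := x) refl (D * S) E₋ ⟩
      D * S           ∎
    disc : a * K * (X₋ - δ * Y₋) ≤ (E - E₋) * q
    disc = begin
      a * K * (X₋ - δ * Y₋)
        ≡⟨ solve 5 (λ δ a L D K →
             a :* K :* ((L :* L :- (L :- D) :* (L :- D)) :- δ :* (L :* L :+ (L :- D) :* (L :- D)))
             := (con 1ℚ :- δ) :* (a :* (L :* L) :* K) :- (con 1ℚ :+ δ) :* (a :* ((L :- D) :* (L :- D)) :* K))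
             refl δ a L D K ⟩
      (1ℚ - δ) * (a * (L * L) * K) - (1ℚ + δ) * (a * ((L - D) * (L - D)) * K)
        ≤⟨ -‿mono-≤ E-lower E₋-upper ⟩
      E * q - E₋ * q
        ≡⟨ solve 3 (λ x y q → x :* q :- y :* q := (x :- y) :* q) refl E E₋ q ⟩
      (E - E₋) * q ∎

  lower : - (S - two * L * α) ≤ α * (D + β * δ * Y)
  lower = ≤-cancel-*ʳ (D * M) (0<-* 0<D 0<M) (begin
    - (S - two * L * α) * (D * M)
      ≡⟨ solve 6 (λ S t L α D M → (:- (S :- t :* L :* α)) :* (D :* M) := t :* L :* D :* (α :* M) :- D :* M :* S)
           refl S two L α D M ⟩
    two * L * D * (α * M) - D * M * S
      ≡⟨ cong (λ w → two * L * D * w - D * M * S) αM≡a ⟩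
    two * L * D * a - D * M * S
      ≤⟨ -‿mono-≤ (≤-refl {two * L * D * a}) R≤DMS ⟩
    two * L * D * a - R
      ≡⟨ solve 4 (λ a L D δ →
           (con 1ℚ :+ con 1ℚ) :* L :* D :* a
             :- a :* ((L :* L :- (L :- D) :* (L :- D)) :- (con 1ℚ :+ con 1ℚ) :* δ :* ((L :+ D) :* (L :+ D) :+ L :* L))
           := a :* (D :* D :+ (con 1ℚ :+ con 1ℚ) :* δ :* ((L :+ D) :* (L :+ D) :+ L :* L))) refl a L D δ ⟩
    a * (D * D + two * δ * Y)
      ≡⟨ scaled-bound ⟩
    α * (D + β * δ * Y) * (D * M) ∎)

  estimate : ∣ S - two * L * α ∣ ≤ α * (D + β * δ * Y)
  estimate = ∣∣≤ upper lower

module RescaledDiscrepancy (δ G C N a K q : ℚ) (G*2≡Na : G * ⟦ 2 ⟧ ≡ N * a)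
                           (C*2≡Nq : C * ⟦ 2 ⟧ ≡ N * q) (0<NK : 0ℚ < N * K) where
  open import Data.Rational.Properties using (module ≤-Reasoning)
  open import Data.Rational.Solver using (module +-*-Solver)
  open +-*-Solver using (solve; _:*_; _:=_)
  open RationalFacts
  open ≤-Reasoning

  private
    edges-scaled : ∀ E → K * E * C * ⟦ 2 ⟧ ≡ E * q * (N * K)
    edges-scaled E = begin-equality
      K * E * C * ⟦ 2 ⟧   ≡⟨ solve 4 (λ K E C t → K :* E :* C :* t := K :* E :* (C :* t)) refl K E C ⟦ 2 ⟧ ⟩
      K * E * (C * ⟦ 2 ⟧) ≡⟨ cong (K * E *_) C*2≡Nq ⟩
      K * E * (N * q)     ≡⟨ solve 4 (λ K E N q → K :* E :* (N :* q) := E :* q :* (N :* K)) refl K E N q ⟩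
      E * q * (N * K)     ∎

    pairs-scaled : ∀ c L → c * (G * (K * L) * (K * L)) * ⟦ 2 ⟧ ≡ c * (a * (L * L) * K) * (N * K)
    pairs-scaled c L = begin-equality
      c * (G * (K * L) * (K * L)) * ⟦ 2 ⟧
        ≡⟨ solve 5 (λ c G t K L → c :* (G :* (K :* L) :* (K :* L)) :* t := c :* (G :* t) :* (K :* L) :* (K :* L))
             refl c G ⟦ 2 ⟧ K L ⟩
      c * (G * ⟦ 2 ⟧) * (K * L) * (K * L)
        ≡⟨ cong (λ w → c * w * (K * L) * (K * L)) G*2≡Na ⟩
      c * (N * a) * (K * L) * (K * L)
        ≡⟨ solve 5 (λ c a L K N → c :* (N :* a) :* (K :* L) :* (K :* L) := c :* (a :* (L :* L) :* K) :* (N :* K))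
             refl c a L K N ⟩
      c * (a * (L * L) * K) * (N * K) ∎

  window-bounds : ∀ L E → (K * E * C) ∼[ δ ] (G * (K * L) * (K * L)) →
    ((1ℚ - δ) * (a * (L * L) * K) ≤ E * q) × (E * q ≤ (1ℚ + δ) * (a * (L * L) * K))
  window-bounds L E (lower , upper) =
    ≤-cancel-*ʳ (N * K) 0<NK (begin
      (1ℚ - δ) * (a * (L * L) * K) * (N * K)   ≡⟨ pairs-scaled (1ℚ - δ) L ⟨
      (1ℚ - δ) * (G * (K * L) * (K * L)) * ⟦ 2 ⟧ ≤⟨ ≤-*ʳ ⟦ 2 ⟧ (0≤⟦⟧ 2) lower ⟩
      K * E * C * ⟦ 2 ⟧                        ≡⟨ edges-scaled E ⟩
      E * q * (N * K)                          ∎) ,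
    ≤-cancel-*ʳ (N * K) 0<NK (begin
      E * q * (N * K)                          ≡⟨ edges-scaled E ⟨
      K * E * C * ⟦ 2 ⟧                        ≤⟨ ≤-*ʳ ⟦ 2 ⟧ (0≤⟦⟧ 2) upper ⟩
      (1ℚ + δ) * (G * (K * L) * (K * L)) * ⟦ 2 ⟧ ≡⟨ pairs-scaled (1ℚ + δ) L ⟩
      (1ℚ + δ) * (a * (L * L) * K) * (N * K)   ∎)

-- Let c ≥ ℓ + d and let the windows [a, a + ℓ) and
-- [a + c, a + c + ℓ), widened by d, stay inside [0, m).  Then the number S of
-- γ ∈ A with ρ(γ) ∈ [c - ℓ, c + ℓ) satisfies
--   ∣ S - 2 ℓ |A| / m ∣ ≤ (|A| / m) (d + (2 δ / d) ((ℓ + d)² + ℓ²)).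
-- Proof: e(ρ⁻¹[b, b + L), ρ⁻¹[b + c, b + c + L)) = K · tent L by the edge count,
-- DISC₂ pins each tent for L ∈ {ℓ - d, ℓ, ℓ + d}, and the tents sandwich d · S.
module HitCount {n : ℕ} (Γ : FinAbGroup n) (A : Subset n) (m : ℕ) .{{_ : NonZero m}}
  (2≤m : 2 ℕ.≤ m) (ρ : Fin n → Fin m) (hom : IsHomZmod Γ m ρ)
  (onto : Surjective _≡_ _≡_ ρ)
  (d ℓ a c : ℕ) .{{_ : NonZero d}} (δ : ℚ) (0<δ : 0ℚ < δ) (δ≤1 : δ ≤ 1ℚ)
  (d≤a : d ℕ.≤ a) (ℓ+d≤c : ℓ ℕ.+ d ℕ.≤ c) (a+c+ℓ≤m : a ℕ.+ c ℕ.+ ℓ ℕ.≤ m)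
  (disc : DISC₂ Γ A δ) (δm≤ℓ-d : δ * ⟦ m ⟧ ≤ ⟦ ℓ ⟧ - ⟦ d ⟧)
  (n≤q : ⟦ n ⟧ ≤ (1ℚ + δ * ½) * (⟦ n ⟧ - 1ℚ)) where

  import Data.Rational.Properties as ℚP
  open import Data.Fin using (fromℕ<)
  open import Data.Fin.Properties using (nonZeroIndex)
  open import Data.Vec using (lookup)
  open import Data.Nat.Combinatorics using (_C_)
  open import Data.Nat.Tactic.RingSolver using (solve-∀)
  open import Function using (_∘_)
  open FiniteSums using (bit)
  open Windows using (tent; hits; tent-widen-sum; tent-narrow-sum)
  open ZmodHomomorphism Γ ρ hom using (r)
  open ZmodHomomorphism.Fibres Γ ρ hom onto using (K; order≡K*m; card-window; windows-disjoint; module WindowEdges)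
  open RationalFacts
  open Pairs using (choose2*2)

  #A : ℕ
  #A = Data.Fin.Subset.∣ A ∣

  tentA : ℕ → ℕ
  tentA = tent (bit ∘ lookup A) r c

  #hits : ℕ
  #hits = hits (bit ∘ lookup A) r (c ℕ.∸ ℓ) (c ℕ.+ ℓ)

  N q α β : ℚ
  N = ⟦ n ⟧
  q = N - 1ℚ
  α = + #A / m
  β = + 2 / d

  -- n = K m, and K ≥ 1 since Γ is inhabited (ρ hits 0); hence n ≥ m ≥ 2.
  1≤n : 1 ℕ.≤ n
  1≤n = ℕ.>-nonZero⁻¹ n {{nonZeroIndex (proj₁ (onto (fromℕ< (ℕ.>-nonZero⁻¹ m))))}}

  1≤K : 1 ℕ.≤ K
  1≤K = ℕP.n≢0⇒n>0 λ K≡0 → ℕP.<⇒≢ 1≤n (sym (trans order≡K*m (cong (ℕ._* m) K≡0)))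

  2≤n : 2 ℕ.≤ n
  2≤n = ℕP.≤-trans 2≤m (subst (m ℕ.≤_) (sym order≡K*m) (ℕP.m≤n*m m K {{ℕ.>-nonZero 1≤K}}))

  d≤ℓ : d ℕ.≤ ℓ
  d≤ℓ = ⟦≤⟧⁻¹ (0≤-⇒≤ (ℚP.≤-trans (0≤-* (ℚP.<⇒≤ 0<δ) (0≤⟦⟧ m)) δm≤ℓ-d))

  q≡ : q ≡ ⟦ n ℕ.∸ 1 ⟧
  q≡ = sym (⟦∸⟧ n 1 1≤n)

  m*K≡n : ⟦ m ⟧ * ⟦ K ⟧ ≡ N
  m*K≡n = trans (sym (⟦*⟧ m K)) (cong ⟦_⟧ (trans (ℕP.*-comm m K) (sym order≡K*m)))

  -- Windows of length L ≥ ℓ - d have K L ≥ δ n elements, as DISC₂ requires.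
  large-window : ∀ L → ℓ ℕ.∸ d ℕ.≤ L → δ * N ≤ ⟦ K ⟧ * ⟦ L ⟧
  large-window L ℓ∸d≤L = begin
    δ * N                    ≡⟨ cong (δ *_) m*K≡n ⟨
    δ * (⟦ m ⟧ * ⟦ K ⟧)      ≡⟨ ℚP.*-assoc δ ⟦ m ⟧ ⟦ K ⟧ ⟨
    δ * ⟦ m ⟧ * ⟦ K ⟧        ≤⟨ ≤-*ʳ ⟦ K ⟧ (0≤⟦⟧ K) δm≤ℓ-d ⟩
    (⟦ ℓ ⟧ - ⟦ d ⟧) * ⟦ K ⟧  ≡⟨ cong (_* ⟦ K ⟧) (⟦∸⟧ ℓ d d≤ℓ) ⟨
    ⟦ ℓ ℕ.∸ d ⟧ * ⟦ K ⟧      ≤⟨ ≤-*ʳ ⟦ K ⟧ (0≤⟦⟧ K) (⟦≤⟧ ℓ∸d≤L) ⟩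
    ⟦ L ⟧ * ⟦ K ⟧            ≡⟨ ℚP.*-comm ⟦ L ⟧ ⟦ K ⟧ ⟩
    ⟦ K ⟧ * ⟦ L ⟧            ∎
    where open ℚP.≤-Reasoning

  open RescaledDiscrepancy δ (eG Γ A) ⟦ n C 2 ⟧ N ⟦ #A ⟧ ⟦ K ⟧ q
    (trans (/-*-cancel (n ℕ.* #A) 2) (⟦*⟧ n #A))
    (trans (sym (⟦*⟧ (n C 2) 2)) (trans (cong ⟦_⟧ (choose2*2 n))
      (trans (⟦*⟧ n (n ℕ.∸ 1)) (cong (N *_) (sym q≡)))))
    (0<-* (⟦<⟧ 1≤n) (⟦<⟧ 1≤K))

  TentBounds : ℕ → Set
  TentBounds L = ((1ℚ - δ) * (⟦ #A ⟧ * (⟦ L ⟧ * ⟦ L ⟧) * ⟦ K ⟧) ≤ ⟦ tentA L ⟧ * q) ×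
                 (⟦ tentA L ⟧ * q ≤ (1ℚ + δ) * (⟦ #A ⟧ * (⟦ L ⟧ * ⟦ L ⟧) * ⟦ K ⟧))

  tent-bounds : ∀ b L → L ℕ.≤ c → b ℕ.+ c ℕ.+ L ℕ.≤ m → ℓ ℕ.∸ d ℕ.≤ L → TentBounds L
  tent-bounds b L L≤c bcL≤m ℓ∸d≤L = window-bounds ⟦ L ⟧ ⟦ tentA L ⟧
    (subst₂ _∼[ δ ]_ (cong (_* ⟦ n C 2 ⟧) edges-count) (cong₂ (λ u w → eG Γ A * u * w) size-U size-W)
      (disc U W (windows-disjoint b L (b ℕ.+ c) L (ℕP.+-monoʳ-≤ b L≤c))
        (subst (δ * N ≤_) (sym size-U) (large-window L ℓ∸d≤L))
        (subst (δ * N ≤_) (sym size-W) (large-window L ℓ∸d≤L))))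
    where
    open WindowEdges A b L c L≤c bcL≤m
    bL≤m : b ℕ.+ L ℕ.≤ m
    bL≤m = ℕP.≤-trans (ℕP.+-monoʳ-≤ b L≤c) (ℕP.≤-trans (ℕP.m≤m+n (b ℕ.+ c) L) bcL≤m)
    size-U : ⟦ Data.Fin.Subset.∣ U ∣ ⟧ ≡ ⟦ K ⟧ * ⟦ L ⟧
    size-U = trans (cong ⟦_⟧ (card-window b L bL≤m)) (⟦*⟧ K L)
    size-W : ⟦ Data.Fin.Subset.∣ W ∣ ⟧ ≡ ⟦ K ⟧ * ⟦ L ⟧
    size-W = trans (cong ⟦_⟧ (card-window (b ℕ.+ c) L bcL≤m)) (⟦*⟧ K L)
    edges-count : ⟦ eBetween Γ A U W ⟧ ≡ ⟦ K ⟧ * ⟦ tentA L ⟧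
    edges-count = trans (cong ⟦_⟧ edges) (⟦*⟧ K (tentA L))

  ℓ≤c : ℓ ℕ.≤ c
  ℓ≤c = ℕP.≤-trans (ℕP.m≤m+n ℓ d) ℓ+d≤c

  -- Tents of half-width ℓ + d (windows starting at a - d), ℓ and ℓ - d (starting at a).
  bounds₊ : TentBounds (ℓ ℕ.+ d)
  bounds₊ = tent-bounds (a ℕ.∸ d) (ℓ ℕ.+ d) ℓ+d≤c
    (subst (ℕ._≤ m)
      (sym (trans (shift (a ℕ.∸ d) c ℓ d) (cong (λ z → z ℕ.+ c ℕ.+ ℓ) (ℕP.m∸n+n≡m d≤a)))) a+c+ℓ≤m)
    (ℕP.≤-trans (ℕP.m∸n≤m ℓ d) (ℕP.m≤m+n ℓ d))
    where
    shift : ∀ x c ℓ d → x ℕ.+ c ℕ.+ (ℓ ℕ.+ d) ≡ x ℕ.+ d ℕ.+ c ℕ.+ ℓ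
    shift = solve-∀
  bounds₀ : TentBounds ℓ
  bounds₀ = tent-bounds a ℓ ℓ≤c a+c+ℓ≤m (ℕP.m∸n≤m ℓ d)
  bounds₋ : TentBounds (ℓ ℕ.∸ d)
  bounds₋ = tent-bounds a (ℓ ℕ.∸ d) (ℕP.≤-trans (ℕP.m∸n≤m ℓ d) ℓ≤c)
    (ℕP.≤-trans (ℕP.+-monoʳ-≤ (a ℕ.+ c) (ℕP.m∸n≤m ℓ d)) a+c+ℓ≤m) ℕP.≤-refl

  upper₊ : ⟦ tentA (ℓ ℕ.+ d) ⟧ * q ≤ (1ℚ + δ) * (⟦ #A ⟧ * ((⟦ ℓ ⟧ + ⟦ d ⟧) * (⟦ ℓ ⟧ + ⟦ d ⟧)) * ⟦ K ⟧)
  upper₊ = subst (λ z → ⟦ tentA (ℓ ℕ.+ d) ⟧ * q ≤ (1ℚ + δ) * (⟦ #A ⟧ * (z * z) * ⟦ K ⟧))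
    (⟦+⟧ ℓ d) (proj₂ bounds₊)

  upper₋ : ⟦ tentA (ℓ ℕ.∸ d) ⟧ * q ≤ (1ℚ + δ) * (⟦ #A ⟧ * ((⟦ ℓ ⟧ - ⟦ d ⟧) * (⟦ ℓ ⟧ - ⟦ d ⟧)) * ⟦ K ⟧)
  upper₋ = subst (λ z → ⟦ tentA (ℓ ℕ.∸ d) ⟧ * q ≤ (1ℚ + δ) * (⟦ #A ⟧ * (z * z) * ⟦ K ⟧))
    (⟦∸⟧ ℓ d d≤ℓ) (proj₂ bounds₋)

  ⟦d*hits+_⟧ : ∀ x → ⟦ d ℕ.* #hits ℕ.+ x ⟧ ≡ ⟦ d ⟧ * ⟦ #hits ⟧ + ⟦ x ⟧
  ⟦d*hits+ x ⟧ = trans (⟦+⟧ (d ℕ.* #hits) x) (cong (_+ ⟦ x ⟧) (⟦*⟧ d #hits))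

  widen : ⟦ d ⟧ * ⟦ #hits ⟧ + ⟦ tentA ℓ ⟧ ≤ ⟦ tentA (ℓ ℕ.+ d) ⟧
  widen = subst (_≤ ⟦ tentA (ℓ ℕ.+ d) ⟧) ⟦d*hits+ tentA ℓ ⟧
    (⟦≤⟧ (tent-widen-sum (bit ∘ lookup A) r c ℓ d))

  narrow : ⟦ tentA ℓ ⟧ ≤ ⟦ d ⟧ * ⟦ #hits ⟧ + ⟦ tentA (ℓ ℕ.∸ d) ⟧
  narrow = subst (⟦ tentA ℓ ⟧ ≤_) ⟦d*hits+ tentA (ℓ ℕ.∸ d) ⟧
    (⟦≤⟧ (tent-narrow-sum (bit ∘ lookup A) r c ℓ d))

  open Estimate δ ⟦ #A ⟧ ⟦ m ⟧ ⟦ d ⟧ ⟦ ℓ ⟧ ⟦ #hits ⟧ q N ⟦ K ⟧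
    ⟦ tentA (ℓ ℕ.+ d) ⟧ ⟦ tentA ℓ ⟧ ⟦ tentA (ℓ ℕ.∸ d) ⟧ α β
    0<δ δ≤1 (0≤⟦⟧ #A) (⟦<⟧ (ℕ.>-nonZero⁻¹ m)) (⟦<⟧ (ℕ.>-nonZero⁻¹ d)) (0≤⟦⟧ ℓ) (0≤⟦⟧ #hits)
    (subst (0ℚ <_) (sym q≡) (⟦<⟧ (ℕP.∸-monoˡ-≤ 1 2≤n)))
    (subst (_≤ N) (sym q≡) (⟦≤⟧ (ℕP.m∸n≤m n 1)))
    n≤q m*K≡n (/-*-cancel #A m) (/-*-cancel 2 d) widen narrow (proj₁ bounds₀)
    upper₊ upper₋ using (estimate)

  error : ℚ
  error = α * (⟦ d ⟧ + (β * δ) * ((⟦ ℓ ⟧ + ⟦ d ⟧) * (⟦ ℓ ⟧ + ⟦ d ⟧) + ⟦ ℓ ⟧ * ⟦ ℓ ⟧))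

  hit-estimate : ∣ ⟦ #hits ⟧ - ⟦ 2 ℕ.* ℓ ⟧ * α ∣ ≤ error
  hit-estimate = subst (λ z → ∣ ⟦ #hits ⟧ - z * α ∣ ≤ error) (sym (⟦*⟧ 2 ℓ)) estimate

-- Hypothesis (i) of the theorem, 0 ≤ s - d < s + ℓ ≤ t - d < t + ℓ ≤ m/2, read in ℕ
-- with c = t - s (only its non-strict inequalities are needed).
module Arrangement (m d ℓ s t : ℕ) (0≤s-d : 0ℚ ≤ ⟦ s ⟧ - ⟦ d ⟧)
  (s+ℓ≤t-d : ⟦ s ⟧ + ⟦ ℓ ⟧ ≤ ⟦ t ⟧ - ⟦ d ⟧) (t+ℓ≤m/2 : ⟦ t ⟧ + ⟦ ℓ ⟧ ≤ + m / 2) where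
  open RationalFacts using (⟦+⟧; ⟦≤⟧⁻¹; 0≤-⇒≤; ≤-⇒+≤; ⟦⟧≤/⇒*≤)

  c : ℕ
  c = t ℕ.∸ s

  d≤s : d ℕ.≤ s
  d≤s = ⟦≤⟧⁻¹ (0≤-⇒≤ 0≤s-d)

  s+ℓ+d≤t : s ℕ.+ ℓ ℕ.+ d ℕ.≤ t
  s+ℓ+d≤t = ⟦≤⟧⁻¹ (subst (_≤ ⟦ t ⟧) (sym (trans (⟦+⟧ (s ℕ.+ ℓ) d) (cong (_+ ⟦ d ⟧) (⟦+⟧ s ℓ))))
    (≤-⇒+≤ s+ℓ≤t-d))

  s≤t : s ℕ.≤ t
  s≤t = ℕP.≤-trans (ℕP.m≤m+n s (ℓ ℕ.+ d)) (subst (ℕ._≤ t) (ℕP.+-assoc s ℓ d) s+ℓ+d≤t)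

  ℓ+d≤c : ℓ ℕ.+ d ℕ.≤ c
  ℓ+d≤c = ℕP.m+n≤o⇒m≤o∸n (ℓ ℕ.+ d)
    (subst (ℕ._≤ t) (trans (ℕP.+-assoc s ℓ d) (ℕP.+-comm s (ℓ ℕ.+ d))) s+ℓ+d≤t)

  s+c+ℓ≤m : s ℕ.+ c ℕ.+ ℓ ℕ.≤ m
  s+c+ℓ≤m = subst (λ z → z ℕ.+ ℓ ℕ.≤ m) (sym (ℕP.m+[n∸m]≡n s≤t))
    (ℕP.≤-trans (ℕP.m≤m*n (t ℕ.+ ℓ) 2)
      (⟦⟧≤/⇒*≤ (t ℕ.+ ℓ) m 2 (subst (_≤ + m / 2) (sym (⟦+⟧ t ℓ)) t+ℓ≤m/2)))

  c+ℓ≤m : c ℕ.+ ℓ ℕ.≤ m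
  c+ℓ≤m = ℕP.≤-trans (ℕP.+-monoˡ-≤ ℓ (ℕP.m≤n+m c s)) s+c+ℓ≤m

  t-s≡c : + t ℤ.- + s ≡ + c
  t-s≡c = trans (ℤP.m-n≡m⊖n t s) (ℤP.⊖-≥ s≤t)

  lower-end : + t ℤ.- + s ℤ.- + ℓ ≡ + (c ℕ.∸ ℓ)
  lower-end = trans (cong (ℤ._- + ℓ) t-s≡c)
    (trans (ℤP.m-n≡m⊖n c ℓ) (ℤP.⊖-≥ (ℕP.≤-trans (ℕP.m≤m+n ℓ d) ℓ+d≤c)))

  upper-end : + t ℤ.- + s ℤ.+ + ℓ ≡ + (c ℕ.+ ℓ)
  upper-end = cong (ℤ._+ + ℓ) t-s≡c

lemmaA11 : ∀ {n : ℕ} (Γ : FinAbGroup n) (A : Subset n) →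
    (FinAbGroup.0g Γ ∈ A → ⊥) →
    (∀ x → x ∈ A → FinAbGroup.⊝_ Γ x ∈ A) →
    ∀ (m : ℕ) .{{_ : NonZero m}} → 2 ℕ.≤ m →
    (ρ : Fin n → Fin m) → IsHomZmod Γ m ρ → Surjective _≡_ _≡_ ρ →
    ∀ (d ℓ s t : ℕ) .{{_ : NonZero d}} → 1 ℕ.≤ ℓ → 1 ℕ.≤ s → 1 ℕ.≤ t →
    (δ : ℚ) → 0ℚ < δ → δ ≤ 1ℚ →
    0ℚ ≤ ⟦ s ⟧ - ⟦ d ⟧ → ⟦ s ⟧ - ⟦ d ⟧ < ⟦ s ⟧ + ⟦ ℓ ⟧ →
    ⟦ s ⟧ + ⟦ ℓ ⟧ ≤ ⟦ t ⟧ - ⟦ d ⟧ → ⟦ t ⟧ - ⟦ d ⟧ < ⟦ t ⟧ + ⟦ ℓ ⟧ →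
    ⟦ t ⟧ + ⟦ ℓ ⟧ ≤ + m / 2 →
    DISC₂ Γ A δ →
    δ * ⟦ m ⟧ ≤ ⟦ ℓ ⟧ - ⟦ d ⟧ →
    ⟦ n ⟧ ∼[ δ * ½ ] (⟦ n ⟧ - 1ℚ) →
    (S : Subset n) →
    (∀ γ → γ ∈ S ⇔ (γ ∈ A × InPreimage Γ m ρ (+ t ℤ.- + s ℤ.- + ℓ) (+ t ℤ.- + s ℤ.+ + ℓ) γ)) →
    ∣ ⟦ Data.Fin.Subset.∣ S ∣ ⟧ - (+ (2 ℕ.* ℓ) / 1) * (+ Data.Fin.Subset.∣ A ∣ / m) ∣
      ≤ (+ Data.Fin.Subset.∣ A ∣ / m) *
        (⟦ d ⟧ + ((+ 2 / d) * δ) * ((⟦ ℓ ⟧ + ⟦ d ⟧) * (⟦ ℓ ⟧ + ⟦ d ⟧) + ⟦ ℓ ⟧ * ⟦ ℓ ⟧))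
lemmaA11 {n} Γ A _ _ m 2≤m ρ hom onto d ℓ s t _ _ _ δ 0<δ δ≤1 0≤s-d _ s+ℓ≤t-d _ t+ℓ≤m/2 disc δm≤ℓ-d n∼q S S⇔ =
  subst (λ h → ∣ ⟦ h ⟧ - ⟦ 2 ℕ.* ℓ ⟧ * α ∣ ≤ error) (sym #S≡#hits) hit-estimate
  where
  open Arrangement m d ℓ s t 0≤s-d s+ℓ≤t-d t+ℓ≤m/2
  open HitCount Γ A m 2≤m ρ hom onto d ℓ s c δ 0<δ δ≤1 d≤s ℓ+d≤c s+c+ℓ≤m disc δm≤ℓ-d (proj₂ n∼q)
  open ZmodHomomorphism Γ ρ hom using (card-A∩preimage)

  #S≡#hits : Data.Fin.Subset.∣ S ∣ ≡ #hits
  #S≡#hits = card-A∩preimage A S (c ℕ.∸ ℓ) (c ℕ.+ ℓ) c+ℓ≤m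
    (subst₂ (λ lo hi → ∀ γ → γ ∈ S ⇔ (γ ∈ A × InPreimage Γ m ρ lo hi γ)) lower-end upper-end S⇔)
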